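{- Let $x$ and $y$ be two states of an LTS. Then $x \sqsubseteq_{must} y$ iff $[\![\{y\}]\!] \sqsubseteq_{\mathcal{M}} [\![\{x\}]\!]$, and $x\sim_{must}y$ iff $[\![\{x\}]\!]=[\![\{y\}]\!]$.
   Context: Consider an LTS with state set $S$ over $A\cup\{\tau\}$. Write $\xRightarrow{\varepsilon}$ for $\xrightarrow{\tau}^*$ and $\xRightarrow{a}$ for $\xrightarrow{\tau}^*\xrightarrow{a}\xrightarrow{\tau}^*$, extended to words. $x$ diverges ($x\not\downarrow$) if it can perform an infinite sequence of $\tau$-steps; $x\downarrow\varepsilon$ iff $x$ does not diverge, and $x\downarrow aw$ iff $x\downarrow\varepsilon$ and $x'\downarrow w$ for every $x'$ with $x\xRightarrow{a}x'$. The acceptance set is $A(x,w)=\{\{a\in A\mid x'\xrightarrow{a}\}\mid x\xRightarrow{w}x',\ x'\not\xrightarrow{\tau}\}$. For $B,C\subseteq\mathcal{P}(A)$, $B\subset\subset C$ iff for every $B_i\in B$ there is $C_i\in C$ with $C_i\subseteq B_i$. Must preorder: $x\sqsubseteq_{must}y$ iff for all $w\in A^*$, if $x\downarrow w$ then $y\downarrow w$ and $A(y,w)\subset\subset A(x,w)$; $x\sim_{must}y$ iff $x\sqsubseteq_{must}y$ and $y\sqsubseteq_{must}x$. Coalgebraic model: $t\colon S\to(1+\mathcal{P}_\omega S)^A$ with $1=\{\top\}$, $t(x)(a)=\top$ if $x\not\downarrow a$, otherwise $t(x)(a)=\{y\mid x\xRightarrow{a}y\}$; output $o\colon S\to 1+\mathcal{P}_\omega(\mathcal{P}_\omega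 A)$ with $o(x)=\top$ if $x\not\downarrow$, $o(x)=\bigcup_{x\xrightarrow{\tau}x'}o(x')$ if $x\xrightarrow{\tau}$, and $o(x)=\{Z\subseteq A\mid Z\cap\{a\mid t(x)(a)\neq\emptyset\}=\emptyset\}$ otherwise. On $1+\mathcal{P}(U)$ the join $\sqcup$ is union on subsets, with $\top\sqcup X=X\sqcup\top=\top$, bottom $\emptyset$. The determinisation on $1+\mathcal{P}_\omega S$ is $o^\sharp(\top)=\top$, $o^\sharp(X)=\bigsqcup_{x\in X}o(x)$, $t^\sharp(\top)(a)=\top$, $t^\sharp(X)(a)=\bigsqcup_{x\in X}t(x)(a)$; $[\![-]\!]\colon 1+\mathcal{P}_\omega S\to(1+\mathcal{P}_\omega(\mathcal{P}_\omega A))^{A^*}$ is given by $[\![X]\!](\varepsilon)=o^\sharp(X)$, $[\![X]\!](aw)=[\![t^\sharp(X)(a)]\!](w)$. $\sqsubseteq_{\mathcal{M}}$ is the preorder induced by the pointwise (on $A^*$) join: $f\sqsubseteq_{\mathcal{M}}g$ iff $f\sqcup g=g$. -}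

module Defs where

open import Level using (0ℓ)
open import Data.Nat using (ℕ; suc)
open import Data.Fin using (Fin)
open import Data.Fin.Subset using (Subset; _∈_)
open import Data.List using (List; []; _∷_)
open import Data.Product using (Σ; ∃; _×_; _,_)
open import Data.Sum using (_⊎_)
open import Data.Empty using (⊥)
open import Relation.Nullary using (¬_)
open import Relation.Binary.PropositionalEquality using (_≡_)
open import Relation.Binary.Construct.Closure.ReflexiveTransitive using (Star)
open import Function.Bundles using (_⇔_)

data Label (n : ℕ) : Set where
  τ   : Label n
  act : Fin n → Label n

record LTS (n : ℕ) : Set₁ where
  field
    State : Set
    _—[_]→_ : State → Label n → State → Set

-- The lattice 1 + P(U): a "top" proposition (the element ⊤) together
-- with a membership predicate (the subset, relevant only when not ⊤).
-- Elements are compared classically via _≈T_ below.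

record TopP (U : Set) : Set₁ where
  constructor ⟨_,_⟩
  field
    top : Set
    mem : U → Set
open TopP public

_≈T_ : {U : Set} → TopP U → TopP U → Set
r ≈T s = (top r ⇔ top s) × (¬ top r → ∀ u → mem r u ⇔ mem s u)

_⊔T_ : {U : Set} → TopP U → TopP U → TopP U
r ⊔T s = ⟨ top r ⊎ top s , (λ u → mem r u ⊎ mem s u) ⟩

∅T : {U : Set} → TopP U
∅T = ⟨ ⊥ , (λ _ → ⊥) ⟩

｛_｝ : {U : Set} → U → TopP U
｛ x ｝ = ⟨ ⊥ , (λ y → y ≡ x) ⟩

-- a set B ⊆ P(A) given as the image of an indexed family of subsets of A
record Fam (n : ℕ) : Set₁ where
  field
    Idx  : Set
    elem : Idx → Fin n → Set
open Fam public

_⊂⊂_ : {n : ℕ} → Fam n → Fam n → Set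
B ⊂⊂ C = ∀ i → ∃ λ j → ∀ a → elem C j a → elem B i a

module _ {n : ℕ} (L : LTS n) where
  open LTS L

  τstep : State → State → Set
  τstep x y = x —[ τ ]→ y

  WeakE : State → State → Set
  WeakE = Star τstep

  WeakA : State → Fin n → State → Set
  WeakA x a y = ∃ λ u → ∃ λ v → WeakE x u × (u —[ act a ]→ v) × WeakE v y

  Weak : State → List (Fin n) → State → Set
  Weak x []      y = WeakE x y
  Weak x (a ∷ w) y = ∃ λ z → WeakA x a z × Weak z w y

  Diverges : State → Set
  Diverges x = Σ (ℕ → State) λ f → (f 0 ≡ x) × (∀ i → τstep (f i) (f (suc i)))

  Conv : State → List (Fin n) → Set
  Conv x []      = ¬ Diverges x
  Conv x (a ∷ w) = ¬ Diverges x × (∀ x' → WeakA x a x' → Conv x' w)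

  Stable : State → Set
  Stable x = ∀ x' → ¬ τstep x x'

  Acceptance : State → List (Fin n) → Fam n
  Acceptance x w = record
    { Idx  = Σ State λ x' → Weak x w x' × Stable x'
    ; elem = λ { (x' , _) a → ∃ λ x'' → x' —[ act a ]→ x'' } }

  Must⊑ : State → State → Set
  Must⊑ x y = ∀ w → Conv x w → Conv y w × (Acceptance y w ⊂⊂ Acceptance x w)

  Must∼ : State → State → Set
  Must∼ x y = Must⊑ x y × Must⊑ y x

  t : State → Fin n → TopP State
  t x a = ⟨ ¬ Conv x (a ∷ []) , WeakA x a ⟩

  -- the subset part of o(x), defined by the recursion of the paper:
  -- union over τ-successors if x has a τ-step, otherwise the subsets Z
  -- with Z ∩ {a | t(x)(a) ≠ ∅} = ∅
  data OMem (x : State) (Z : Subset n) : Set where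
    viaτ : ∀ {x'} → τstep x x' → OMem x' Z → OMem x Z
    stop : Stable x → (∀ a → a ∈ Z → ¬ (t x a ≈T ∅T) → ⊥) → OMem x Z

  o : State → TopP (Subset n)
  o x = ⟨ ¬ Conv x [] , OMem x ⟩

  o♯ : TopP State → TopP (Subset n)
  o♯ X = ⟨ top X ⊎ (∃ λ x → mem X x × top (o x))
         , (λ Z → ∃ λ x → mem X x × mem (o x) Z) ⟩

  t♯ : TopP State → Fin n → TopP State
  t♯ X a = ⟨ top X ⊎ (∃ λ x → mem X x × top (t x a))
           , (λ y → ∃ λ x → mem X x × mem (t x a) y) ⟩

  ⟦_⟧ : TopP State → List (Fin n) → TopP (Subset n)
  ⟦ X ⟧ []      = o♯ X
  ⟦ X ⟧ (a ∷ w) = ⟦ t♯ X a ⟧ w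

_⊑M_ : {n : ℕ} → (List (Fin n) → TopP (Subset n)) → (List (Fin n) → TopP (Subset n)) → Set
f ⊑M g = ∀ w → (f w ⊔T g w) ≈T g w

_≈M_ : {n : ℕ} → (List (Fin n) → TopP (Subset n)) → (List (Fin n) → TopP (Subset n)) → Set
f ≈M g = ∀ w → f w ≈T g w

-- The proof is organised around refusals.  A set Z of actions is refused
-- by a family B of acceptance sets if Z is disjoint from some member of B.
--   * Order theory of 1 + P(U): r ⊔ s ≈ s unfolds to "top r → top s, and
--     when s is not ⊤ the subset of r is included in that of s"; mutual
--     ⊑ is equality.  This lifts pointwise to behaviours A* → 1 + P(P A).
--   * Families: B ⊂⊂ C holds iff every refusal of B is a refusal of C
--     (the converse uses the complement of a member of B, so needs EM).
--   * Semantics: by induction on the word w, ⟦X⟧(w) is ⊤ iff X is ⊤ or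
--     some x ∈ X fails x ↓ w, and its subset part consists of the Z that
--     some x ∈ X refuses after w.  The base case is the characterisation
--     of the output o(x) as the refusals of the stable τ-derivatives of x.
-- For singletons these say: ⟦{x}⟧(w) = ⊤ iff ¬ x ↓ w, and otherwise it is
-- the set of refusals of A(x,w).  Comparing both sides word by word gives
-- the first claim; the second follows from it by antisymmetry.
module Submission where

open import Defs
open import Level using (0ℓ)
open import Data.Nat using (ℕ)
open import Data.Product using (_×_)
open import Function.Bundles using (_⇔_)
open import Axiom.ExcludedMiddle using (ExcludedMiddle)

open import Axiom.DoubleNegationElimination using (em⇒dne)
open import Data.Bool using (Bool; true)
open import Data.Fin using (Fin)
open import Data.Fin.Subset using (Subset; _∈_)
open import Data.List using (List; []; _∷_)
open import Data.Product using (∃; _,_; proj₁; proj₂; swap)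
open import Data.Product.Function.NonDependent.Propositional using (_×-⇔_)
open import Data.Sum using (_⊎_; inj₁; inj₂; [_,_])
open import Data.Empty using (⊥-elim)
open import Data.Vec using (tabulate)
open import Data.Vec.Properties using (lookup∘tabulate; []=⇒lookup; lookup⇒[]=)
open import Function using (_∘_)
open import Function.Bundles using (mk⇔; Equivalence)
open import Relation.Nullary using (¬_; Dec; yes; no; does)
open import Relation.Binary.PropositionalEquality using (_≡_; refl; trans) renaming (sym to ≡-sym)
open import Relation.Nullary.Decidable using (dec-true)
open import Relation.Binary.Construct.Closure.ReflexiveTransitive using (ε; _◅_)
open import Function.Properties.Equivalence using () renaming (trans to ⇔-trans; sym to ⇔-sym)
open Equivalence using (to; from)

does-true : {P : Set} (d : Dec P) → does d ≡ true → P
does-true (yes p) _  = p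
does-true (no _)  ()

-- Classically every predicate on Fin n is a subset; `outside P` collects
-- the actions not satisfying P.  It is used to refute ⊂⊂ via a refusal.
module Complement (em : ExcludedMiddle 0ℓ) {n : ℕ} where

  outside : (Fin n → Set) → Subset n
  outside P = tabulate (λ a → does (em {¬ P a}))

  ∈-outside : (P : Fin n → Set) (a : Fin n) → a ∈ outside P ⇔ (¬ P a)
  ∈-outside P a = mk⇔
    (λ a∈ → does-true em (trans (≡-sym (lookup∘tabulate decide a)) ([]=⇒lookup a∈)))
    (λ ¬Pa → lookup⇒[]= a (outside P) (trans (lookup∘tabulate decide a) (dec-true em ¬Pa)))
    where
      decide : Fin n → Bool
      decide b = does (em {¬ P b})

_≤T_ : {U : Set} → TopP U → TopP U → Set
r ≤T s = (top r → top s) × (¬ top s → ∀ u → mem r u → mem s u)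

⊔T-absorbs⇔≤T : {U : Set} {r s : TopP U} → ((r ⊔T s) ≈T s) ⇔ (r ≤T s)
⊔T-absorbs⇔≤T = mk⇔
  (λ (tops , mems) → (λ tr → to tops (inj₁ tr))
                   , (λ ¬ts u mr → to (mems [ ¬ts ∘ to tops ∘ inj₁ , ¬ts ] u) (inj₁ mr)))
  (λ (up , incl) → mk⇔ [ up , (λ ts → ts) ] inj₂
                 , (λ ¬top u → mk⇔ [ incl (¬top ∘ inj₂) u , (λ ms → ms) ] inj₂))

≈T⇔≤T-antisym : {U : Set} {r s : TopP U} → (r ≈T s) ⇔ (r ≤T s × s ≤T r)
≈T⇔≤T-antisym = mk⇔
  (λ (tops , mems) → (to tops , λ ¬ts u → to (mems (¬ts ∘ to tops) u))
                   , (from tops , λ ¬tr u → from (mems ¬tr u)))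
  (λ ((up , incl) , (down , incl′)) →
     mk⇔ up down , λ ¬tr u → mk⇔ (incl (¬tr ∘ down) u) (incl′ ¬tr u))

≈M⇔⊑M-antisym : {n : ℕ} {f g : List (Fin n) → TopP (Subset n)} →
                (f ≈M g) ⇔ (f ⊑M g × g ⊑M f)
≈M⇔⊑M-antisym = mk⇔
  (λ f≈g → (λ w → from ⊔T-absorbs⇔≤T (proj₁ (to ≈T⇔≤T-antisym (f≈g w))))
         , (λ w → from ⊔T-absorbs⇔≤T (proj₂ (to ≈T⇔≤T-antisym (f≈g w)))))
  (λ (f⊑g , g⊑f) w → from ≈T⇔≤T-antisym (to ⊔T-absorbs⇔≤T (f⊑g w) , to ⊔T-absorbs⇔≤T (g⊑f w)))

Refuses : {n : ℕ} → Fam n → Subset n → Set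
Refuses B Z = ∃ λ i → ∀ a → a ∈ Z → ¬ elem B i a

⊂⊂⇒refusals : {n : ℕ} {B C : Fam n} → B ⊂⊂ C → ∀ Z → Refuses B Z → Refuses C Z
⊂⊂⇒refusals B⊂⊂C Z (i , disjoint) =
  let (j , Cj⊆Bi) = B⊂⊂C i in j , λ a a∈Z a∈Cj → disjoint a a∈Z (Cj⊆Bi a a∈Cj)

-- ... and classically they determine ⊂⊂: the complement of B i is refused
-- by B, hence by C, so some C j lies inside B i.
refusals⇒⊂⊂ : ExcludedMiddle 0ℓ → {n : ℕ} {B C : Fam n} →
              (∀ Z → Refuses B Z → Refuses C Z) → B ⊂⊂ C
refusals⇒⊂⊂ em {B = B} refusals i =
  let (j , disjoint) = refusals (outside (elem B i)) (i , λ a → to (∈-outside (elem B i) a))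
  in j , λ a a∈Cj → em⇒dne em (λ a∉Bi → disjoint a (from (∈-outside (elem B i) a) a∉Bi) a∈Cj)
  where open Complement em

module Semantics {n : ℕ} (L : LTS n) where
  open LTS L

  conv⇒¬div : ∀ {x} w → Conv L x w → ¬ Diverges L x
  conv⇒¬div []      x↓ = x↓
  conv⇒¬div (_ ∷ _) x↓ = proj₁ x↓

  -- A divergence starts with a τ-step, which a stable state lacks.
  stable⇒¬div : ∀ {x} → Stable L x → ¬ Diverges L x
  stable⇒¬div stable (f , refl , steps) = stable (f 1) (steps 0)

  module _ {x : State} {a : Fin n} (stable : Stable L x) where

    stuck⇒no-weak : ¬ (∃ λ x″ → x —[ act a ]→ x″) → ∀ {y} → ¬ WeakA L x a y
    stuck⇒no-weak stuck (_ , x″ , ε , step , _) = stuck (x″ , step)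
    stuck⇒no-weak stuck (_ , _ , τ-step ◅ _ , _) = stable _ τ-step

    stuck⇒t-empty : ¬ (∃ λ x″ → x —[ act a ]→ x″) → t L x a ≈T ∅T
    stuck⇒t-empty stuck =
        mk⇔ (λ ¬x↓a → ¬x↓a (stable⇒¬div stable , λ _ weak → ⊥-elim (stuck⇒no-weak stuck weak)))
            ⊥-elim
      , λ _ _ → mk⇔ (stuck⇒no-weak stuck) ⊥-elim

  step⇒t-nonempty : ∀ {x x″ a} → x —[ act a ]→ x″ → ¬ (t L x a ≈T ∅T)
  step⇒t-nonempty {x} {x″} step (tops , mems) = to (mems (to tops) x″) (x , x″ , ε , step , ε)

  OMem⇔refuses : ∀ {x Z} → OMem L x Z ⇔ Refuses (Acceptance L x []) Z
  OMem⇔refuses = mk⇔ refuses-of refused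
    where
      refuses-of : ∀ {x Z} → OMem L x Z → Refuses (Acceptance L x []) Z
      refuses-of (viaτ τ-step omem) =
        let ((x′ , τs , stable) , disjoint) = refuses-of omem
        in (x′ , τ-step ◅ τs , stable) , disjoint
      refuses-of {x} (stop stable disjoint) =
        (x , ε , stable) , λ a a∈Z (_ , step) → disjoint a a∈Z (step⇒t-nonempty step)

      refused : ∀ {x Z} → Refuses (Acceptance L x []) Z → OMem L x Z
      refused ((_ , ε , stable) , disjoint) =
        stop stable λ a a∈Z t≉∅ → t≉∅ (stuck⇒t-empty stable (disjoint a a∈Z))
      refused ((x′ , τ-step ◅ τs , stable) , disjoint) =
        viaτ τ-step (refused ((x′ , τs , stable) , disjoint))

  refuses-step : ∀ {x a w Z} →
    Refuses (Acceptance L x (a ∷ w)) Z ⇔ (∃ λ y → WeakA L x a y × Refuses (Acceptance L y w) Z)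
  refuses-step = mk⇔
    (λ ((x′ , (y , x⇒y , y⇒x′) , stable) , disjoint) → y , x⇒y , (x′ , y⇒x′ , stable) , disjoint)
    (λ (y , x⇒y , (x′ , y⇒x′ , stable) , disjoint) → (x′ , (y , x⇒y , y⇒x′) , stable) , disjoint)

  mem-⟦⟧ : ∀ X w Z → mem (⟦ L ⟧ X w) Z ⇔ (∃ λ x → mem X x × Refuses (Acceptance L x w) Z)
  mem-⟦⟧ X []      Z = mk⇔
    (λ (x , x∈X , omem) → x , x∈X , to OMem⇔refuses omem)
    (λ (x , x∈X , refuses) → x , x∈X , from OMem⇔refuses refuses)
  mem-⟦⟧ X (a ∷ w) Z = ⇔-trans (mem-⟦⟧ (t♯ L X a) w Z) (mk⇔
    (λ (y , (x , x∈X , x⇒y) , refuses) → x , x∈X , from refuses-step (y , x⇒y , refuses))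
    (λ (x , x∈X , refuses) →
       let (y , x⇒y , refuses′) = to refuses-step refuses in y , (x , x∈X , x⇒y) , refuses′))

  -- Convergence is not decidable in general, so the characterisation of
  -- the ⊤ part of the semantics is classical.
  module Classical (em : ExcludedMiddle 0ℓ) where

    ¬conv-step : ∀ {x a w} →
      (¬ Conv L x (a ∷ w)) ⇔ (¬ Conv L x (a ∷ []) ⊎ ∃ λ y → WeakA L x a y × ¬ Conv L y w)
    ¬conv-step {x} {a} {w} = mk⇔ split
      [ (λ ¬x↓a x↓aw → ¬x↓a (proj₁ x↓aw , λ y x⇒y → conv⇒¬div w (proj₂ x↓aw y x⇒y)))
      , (λ (y , x⇒y , ¬y↓w) x↓aw → ¬y↓w (proj₂ x↓aw y x⇒y)) ]
      where
        split : ¬ Conv L x (a ∷ w) → ¬ Conv L x (a ∷ []) ⊎ ∃ λ y → WeakA L x a y × ¬ Conv L y w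
        split ¬x↓aw with em {∃ λ y → WeakA L x a y × ¬ Conv L y w}
        ... | yes bad-derivative  = inj₂ bad-derivative
        ... | no  ¬bad-derivative = inj₁ λ x↓a → ¬x↓aw
          (proj₁ x↓a , λ y x⇒y → em⇒dne em λ ¬y↓w → ¬bad-derivative (y , x⇒y , ¬y↓w))

    top-⟦⟧ : ∀ X w → top (⟦ L ⟧ X w) ⇔ (top X ⊎ ∃ λ x → mem X x × ¬ Conv L x w)
    top-⟦⟧ X []      = mk⇔ (λ t → t) (λ t → t)
    top-⟦⟧ X (a ∷ w) = ⇔-trans (top-⟦⟧ (t♯ L X a) w) (mk⇔
      [ [ inj₁ , (λ (x , x∈X , ¬x↓a) → inj₂ (x , x∈X , from ¬conv-step (inj₁ ¬x↓a))) ]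
      , (λ (y , (x , x∈X , x⇒y) , ¬y↓w) → inj₂ (x , x∈X , from ¬conv-step (inj₂ (y , x⇒y , ¬y↓w)))) ]
      [ inj₁ ∘ inj₁
      , (λ (x , x∈X , ¬x↓aw) → [ (λ ¬x↓a → inj₁ (inj₂ (x , x∈X , ¬x↓a)))
                               , (λ (y , x⇒y , ¬y↓w) → inj₂ (y , (x , x∈X , x⇒y) , ¬y↓w)) ]
                               (to ¬conv-step ¬x↓aw)) ])

    top-⟦｛｝⟧ : ∀ x w → top (⟦ L ⟧ ｛ x ｝ w) ⇔ (¬ Conv L x w)
    top-⟦｛｝⟧ x w = ⇔-trans (top-⟦⟧ ｛ x ｝ w) (mk⇔
      [ (λ ()) , (λ { (_ , refl , ¬x↓w) → ¬x↓w }) ]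
      (λ ¬x↓w → inj₂ (x , refl , ¬x↓w)))

    mem-⟦｛｝⟧ : ∀ x w Z → mem (⟦ L ⟧ ｛ x ｝ w) Z ⇔ Refuses (Acceptance L x w) Z
    mem-⟦｛｝⟧ x w Z = ⇔-trans (mem-⟦⟧ ｛ x ｝ w Z) (mk⇔
      (λ { (_ , refl , refuses) → refuses })
      (λ refuses → x , refl , refuses))

    must-at⇔≤T : ∀ x y w →
      (Conv L x w → Conv L y w × (Acceptance L y w ⊂⊂ Acceptance L x w))
        ⇔ (⟦ L ⟧ ｛ y ｝ w ≤T ⟦ L ⟧ ｛ x ｝ w)
    must-at⇔≤T x y w = mk⇔
      (λ must → (λ ty → from (top-⟦｛｝⟧ x w) λ x↓w → to (top-⟦｛｝⟧ y w) ty (proj₁ (must x↓w)))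
              , (λ ¬tx Z my → from (mem-⟦｛｝⟧ x w Z)
                   (⊂⊂⇒refusals (proj₂ (must (x↓w ¬tx))) Z (to (mem-⟦｛｝⟧ y w Z) my))))
      (λ (up , incl) x↓w →
         let ¬tx = λ tx → to (top-⟦｛｝⟧ x w) tx x↓w
         in em⇒dne em (λ ¬y↓w → ¬tx (up (from (top-⟦｛｝⟧ y w) ¬y↓w)))
          , refusals⇒⊂⊂ em λ Z refuses →
              to (mem-⟦｛｝⟧ x w Z) (incl ¬tx Z (from (mem-⟦｛｝⟧ y w Z) refuses)))
      where
        x↓w : ¬ top (⟦ L ⟧ ｛ x ｝ w) → Conv L x w
        x↓w ¬tx = em⇒dne em (¬tx ∘ from (top-⟦｛｝⟧ x w))

    Must⊑⇔⊑M : ∀ x y → Must⊑ L x y ⇔ (⟦ L ⟧ ｛ y ｝ ⊑M ⟦ L ⟧ ｛ x ｝)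
    Must⊑⇔⊑M x y = mk⇔
      (λ must w → from ⊔T-absorbs⇔≤T (to (must-at⇔≤T x y w) (must w)))
      (λ y⊑x w → from (must-at⇔≤T x y w) (to ⊔T-absorbs⇔≤T (y⊑x w)))

theorem4p10 : ExcludedMiddle 0ℓ → {n : ℕ} (L : LTS n) (x y : LTS.State L) →
    (Must⊑ L x y ⇔ (⟦ L ⟧ ｛ y ｝ ⊑M ⟦ L ⟧ ｛ x ｝))
    × (Must∼ L x y ⇔ (⟦ L ⟧ ｛ x ｝ ≈M ⟦ L ⟧ ｛ y ｝))
theorem4p10 em L x y =
    Must⊑⇔⊑M x y
  , ⇔-trans (Must⊑⇔⊑M x y ×-⇔ Must⊑⇔⊑M y x)
            (⇔-trans (mk⇔ swap swap) (⇔-sym ≈M⇔⊑M-antisym))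
  where open Semantics.Classical L em
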